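{- Let $A$ be a finite abelian group and $B$ a subgroup of $A$ of index $2$. The number of subsets $S\subseteq A\setminus B$ such that $\langle S\rangle$ is a proper subgroup of $A$ is at most $2^{\frac{|A|}{4}+\log_2|A|}$. -}

module Defs where

open import Data.Nat using (ℕ)
open import Data.Fin using (Fin)
open import Data.Fin.Subset using (Subset; _∈_)
open import Data.Product using (_×_)
open import Relation.Binary.PropositionalEquality using (_≡_)
open import Algebra.Core using (Op₁; Op₂)
open import Algebra.Structures using (IsAbelianGroup)

record FinAbGroup (n : ℕ) : Set where
  field
    _∙_ : Op₂ (Fin n)
    ε : Fin n
    _⁻¹ : Op₁ (Fin n)
    isAbelianGroup : IsAbelianGroup _≡_ _∙_ ε _⁻¹

module _ {n : ℕ} (G : FinAbGroup n) where
  open FinAbGroup G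

  IsSubgroup : Subset n → Set
  IsSubgroup B =
    (ε ∈ B) × (∀ x y → x ∈ B → y ∈ B → (x ∙ y) ∈ B) × (∀ x → x ∈ B → (x ⁻¹) ∈ B)

  data Gen (S : Subset n) : Fin n → Set where
    gen  : ∀ {x} → x ∈ S → Gen S x
    unit : Gen S ε
    mul  : ∀ {x y} → Gen S x → Gen S y → Gen S (x ∙ y)
    inv  : ∀ {x} → Gen S x → Gen S (x ⁻¹)

-- Let N = |A|!. For S ⊆ A ∖ B with ⟨S⟩ ≠ A there is a character χ : A → ℤ/N vanishing on ⟨S⟩ but not
-- everywhere: characters extend from a subgroup H to H⟨a⟩, since the compatibility condition
-- k c ≡ χ (a^k), with k the order of a modulo H, is solvable because the order of a is a multiple of k
-- dividing N. Then S ⊆ K ∖ B for the proper subgroup K = ker χ, and |K ∖ B| ≤ |A|/4: translating by an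
-- element of K ∖ B embeds K ∖ B into K ∩ B, while K and aK are disjoint for a ∉ K. A character is
-- determined by one element of A, its code, which records its values digit by digit along the chain of
-- subgroups obtained by adjoining the elements of A one at a time. So L splits into at most |A| classes
-- of equal code, each a family of subsets of a single K ∖ B, and |L| ≤ |A| · 2^(|A|/4).

module Submission where

open import Defs
open import Data.Nat using (ℕ; _*_; _^_; _≤_)
open import Data.Fin.Subset using (Subset; _∈_; _∉_; ∣_∣)
open import Data.List using (List; length)
open import Data.List.Relation.Unary.All using (All)
open import Data.List.Relation.Unary.Unique.Propositional using (Unique)
open import Data.Product using (_×_)
open import Relation.Nullary using (¬_)
open import Relation.Binary.PropositionalEquality using (_≡_)

open import Algebra.Bundles using (AbelianGroup)
open import Algebra.Structures using (IsAbelianGroup)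
open import Data.Empty using (⊥; ⊥-elim)
open import Data.Fin using (Fin; zero; suc; toℕ; fromℕ<)
import Data.Fin.Properties as Fin
open import Data.Fin.Subset using (_⊆_; inside; outside; ⊤; ∁; _∩_; _-_)
open import Data.Fin.Subset.Properties
  using (_∈?_; drop-∷-⊆; ⊆⊤; ∣⊤∣≡n; ∣⊥∣≡0; x∈∁p⇒x∉p; x∉p⇒x∈∁p; x∈p∩q⁺; x∈p∩q⁻; p∩q⊆p;
         x∈p⇒∣p-x∣<∣p∣; x∈p∧x≢y⇒x∈p-y; nonempty?; Empty-unique)
open import Data.List using ([]; _∷_; [_]; _++_; map; concat; filter; allFin)
open import Data.List.Properties using (length-map; length-++; length-removeAt′; length-tabulate)
open import Data.List.Membership.Propositional using () renaming (_∈_ to _∈ₗ_)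
open import Data.List.Membership.Propositional.Properties
  using (∈-map⁺; ∈-map⁻; ∈-++⁺ˡ; ∈-++⁺ʳ; ∈-++⁻; ∈-concat⁺′; ∈-filter⁺; ∈-filter⁻; ∈-allFin)
import Data.List.Relation.Unary.All as All
open import Data.List.Relation.Unary.All using ([]; _∷_)
open import Data.List.Relation.Unary.AllPairs using ([]; _∷_)
open import Data.List.Relation.Unary.Any using (here; there; _─_)
import Data.List.Relation.Unary.Unique.Propositional.Properties as Unique
import Data.Nat as ℕ
open import Data.Nat
  using (zero; suc; _+_; _∸_; _<_; z≤n; s≤s; _%_; _/_; _!; NonZero; >-nonZero; >-nonZero⁻¹; ≢-nonZero⁻¹)
open import Data.Nat.DivMod
open import Data.Nat.Divisibility using (_∣_; ∣-trans; ∣⇒≤; m∣m*n; n∣m*n; m%n≡0⇒n∣m; *-cancelˡ-∣; m≤n⇒m!∣n!)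
open import Data.Nat.Properties
open import Data.Nat.Tactic.RingSolver using (solve-∀)
open import Data.Product using (_,_; ∃-syntax; proj₁; proj₂)
import Data.Product as Product
open import Data.Sum using (inj₁; inj₂)
open import Data.Vec using ([]; _∷_; here; there)
open import Function using (_∘_)
open import Level using (0ℓ)
open import Relation.Binary.Bundles using (Setoid)
import Relation.Binary.Construct.On as On
open import Relation.Binary.PropositionalEquality
  using (refl; cong; cong₂; sym; trans; subst; _≢_; setoid; module ≡-Reasoning)
import Relation.Binary.Reasoning.Setoid as SetoidReasoning
open import Relation.Nullary using (Dec; yes; no; does; _×-dec_; ¬?)
open import Relation.Nullary.Decidable using (decidable-stable)

m≤n⇒m∣n! : ∀ {m n} → 0 < m → m ≤ n → m ∣ n !
m≤n⇒m∣n! {suc m} _ m≤n = ∣-trans (m∣m*n (m !)) (m≤n⇒m!∣n! m≤n)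

least : ∀ {P : ℕ → Set} → (∀ m → Dec (P m)) → ∀ {b} → P b → ∃[ k ] P k × (∀ {j} → j < k → ¬ P j)
least P? {zero} P0 = 0 , P0 , λ ()
least P? {suc b} Pb with P? 0
... | yes P0 = 0 , P0 , λ ()
... | no ¬P0 with least (P? ∘ suc) Pb
...   | k , Pk , below = suc k , Pk , λ { {zero} _ → ¬P0 ; {suc j} (s≤s j<k) → below j<k }

[m*2^[m/4]]^4≤2^m*m^4 : ∀ m → (m * 2 ^ (m / 4)) ^ 4 ≤ 2 ^ m * m ^ 4
[m*2^[m/4]]^4≤2^m*m^4 m = begin
  (m * 2 ^ (m / 4)) ^ 4       ≡⟨ swap m (2 ^ (m / 4)) ⟩
  (2 ^ (m / 4)) ^ 4 * m ^ 4   ≡⟨ cong (_* m ^ 4) (^-*-assoc 2 (m / 4) 4) ⟩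
  2 ^ (m / 4 * 4) * m ^ 4     ≤⟨ *-monoˡ-≤ (m ^ 4) (^-monoʳ-≤ 2 (m/n*n≤m m 4)) ⟩
  2 ^ m * m ^ 4               ∎
  where
  open ≤-Reasoning
  -- x ^ 4 written out as products, the form in which the ring solver accepts it
  swap : ∀ m t → (m * t) * ((m * t) * ((m * t) * ((m * t) * 1))) ≡ (t * (t * (t * (t * 1)))) * (m * (m * (m * (m * 1))))
  swap = solve-∀

module Modulo (N : ℕ) .{{N≢0 : NonZero N}} where

  infix 4 _≋_
  _≋_ : ℕ → ℕ → Set
  a ≋ b = a % N ≡ b % N

  ≋-setoid : Setoid 0ℓ 0ℓ
  ≋-setoid = On.setoid (setoid ℕ) (_% N)

  %-≋ : ∀ a → a % N ≋ a
  %-≋ a = m%n%n≡m%n a N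

  ≋0⇒%≡0 : ∀ {a} → a ≋ 0 → a % N ≡ 0
  ≋0⇒%≡0 a≋0 = trans a≋0 (m<n⇒m%n≡m (>-nonZero⁻¹ N))

  N≋0 : N ≋ 0
  N≋0 = trans (n%n≡0 N) (sym (m<n⇒m%n≡m (>-nonZero⁻¹ N)))

  m<N∧m≋0⇒m≡0 : ∀ {m} → m < N → m ≋ 0 → m ≡ 0
  m<N∧m≋0⇒m≡0 m<N m≋0 = trans (sym (m<n⇒m%n≡m m<N)) (≋0⇒%≡0 m≋0)

  +-cong-≋ : ∀ {a b c d} → a ≋ b → c ≋ d → a + c ≋ b + d
  +-cong-≋ {a} {b} {c} {d} a≋b c≋d = begin
    (a + c) % N             ≡⟨ %-distribˡ-+ a c N ⟩
    (a % N + c % N) % N     ≡⟨ cong₂ (λ x y → (x + y) % N) a≋b c≋d ⟩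
    (b % N + d % N) % N     ≡⟨ %-distribˡ-+ b d N ⟨
    (b + d) % N             ∎
    where open ≡-Reasoning

  +-congˡ-≋ : ∀ a {b c} → b ≋ c → a + b ≋ a + c
  +-congˡ-≋ a = +-cong-≋ {a} refl

  +-congʳ-≋ : ∀ c {a b} → a ≋ b → a + c ≋ b + c
  +-congʳ-≋ c a≋b = +-cong-≋ {c = c} a≋b refl

  *-congˡ-≋ : ∀ m {a b} → a ≋ b → m * a ≋ m * b
  *-congˡ-≋ m {a} {b} a≋b = begin
    (m * a) % N             ≡⟨ %-distribˡ-* m a N ⟩
    (m % N * (a % N)) % N   ≡⟨ cong (λ x → (m % N * x) % N) a≋b ⟩
    (m % N * (b % N)) % N   ≡⟨ %-distribˡ-* m b N ⟨
    (m * b) % N             ∎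
    where open ≡-Reasoning

  +-cancelˡ-≋ : ∀ a {b c} → a + b ≋ a + c → b ≋ c
  +-cancelˡ-≋ a {b} {c} a+b≋a+c = begin
    b                   ≈⟨ +-congʳ-≋ b −a+a≋0 ⟨
    (−a + a) + b        ≡⟨ +-assoc −a a b ⟩
    −a + (a + b)        ≈⟨ +-congˡ-≋ −a a+b≋a+c ⟩
    −a + (a + c)        ≡⟨ +-assoc −a a c ⟨
    (−a + a) + c        ≈⟨ +-congʳ-≋ c −a+a≋0 ⟩
    c                   ∎
    where
    open SetoidReasoning ≋-setoid
    −a = N ∸ a % N
    −a+a≋0 : −a + a ≋ 0
    −a+a≋0 = begin
      −a + a            ≈⟨ +-congˡ-≋ −a (%-≋ a) ⟨
      −a + a % N        ≡⟨ m∸n+n≡m (m%n≤n a N) ⟩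
      N                 ≈⟨ N≋0 ⟩
      0                 ∎

  k*[t%N/k]≋t : ∀ q k t .{{_ : NonZero q}} .{{_ : NonZero k}} → q * k ∣ N → q * t ≋ 0 →
                k * (t % N / k) ≋ t
  k*[t%N/k]≋t q k t qk∣N qt≋0 = trans (cong (_% N) (m*[n/m]≡n k∣t%N)) (%-≋ t)
    where
    N∣q[t%N] : N ∣ q * (t % N)
    N∣q[t%N] = m%n≡0⇒n∣m _ N (≋0⇒%≡0 (trans (*-congˡ-≋ q (%-≋ t)) qt≋0))
    k∣t%N : k ∣ t % N
    k∣t%N = *-cancelˡ-∣ q (∣-trans qk∣N N∣q[t%N])

  k*c≋k*d∧[c%N]/u≡[d%N]/u⇒c≋d : ∀ k u c d .{{_ : NonZero k}} .{{_ : NonZero u}} → N ≡ k * u →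
                                 k * c ≋ k * d → c % N / u ≡ d % N / u → c ≋ d
  k*c≋k*d∧[c%N]/u≡[d%N]/u⇒c≋d k u c d N≡ku kc≋kd c/u≡d/u = begin
    c % N                       ≡⟨ m≡m%n+[m/n]*n (c % N) u ⟩
    c % N % u + c % N / u * u   ≡⟨ cong₂ (λ x y → x + y * u) c%u≡d%u c/u≡d/u ⟩
    d % N % u + d % N / u * u   ≡⟨ m≡m%n+[m/n]*n (d % N) u ⟨
    d % N                       ∎
    where
    open ≡-Reasoning
    instance
      uk≢0 : NonZero (u * k)
      uk≢0 = m*n≢0 u k
    N≡uk : N ≡ u * k
    N≡uk = trans N≡ku (*-comm k u)
    k*x%N≡x%u*k : ∀ x → k * x % N ≡ x % u * k
    k*x%N≡x%u*k x = begin
      k * x % N                 ≡⟨ %-congʳ N≡uk ⟩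
      k * x % (u * k)           ≡⟨ cong (_% (u * k)) (*-comm k x) ⟩
      x * k % (u * k)           ≡⟨ m%n*o≡m*o%[n*o] x u k ⟨
      x % u * k                 ∎
    c%u≡d%u : c % N % u ≡ d % N % u
    c%u≡d%u = *-cancelʳ-≡ _ _ k (begin
      c % N % u * k             ≡⟨ k*x%N≡x%u*k (c % N) ⟨
      k * (c % N) % N           ≡⟨ *-congˡ-≋ k (%-≋ c) ⟩
      k * c % N                 ≡⟨ kc≋kd ⟩
      k * d % N                 ≡⟨ *-congˡ-≋ k (%-≋ d) ⟨
      k * (d % N) % N           ≡⟨ k*x%N≡x%u*k (d % N) ⟩
      d % N % u * k             ∎)

∈-─⁺ : ∀ {A : Set} {x z : A} {ys} (x∈ys : x ∈ₗ ys) → z ∈ₗ ys → z ≢ x → z ∈ₗ (ys ─ x∈ys)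
∈-─⁺ (here refl) (here refl) z≢x = ⊥-elim (z≢x refl)
∈-─⁺ (here refl) (there z∈ys) _ = z∈ys
∈-─⁺ (there x∈ys) (here z≡y) _ = here z≡y
∈-─⁺ (there x∈ys) (there z∈ys) z≢x = there (∈-─⁺ x∈ys z∈ys z≢x)

unique⊆⇒length≤ : ∀ {A : Set} {xs ys : List A} → Unique xs →
                  (∀ {z} → z ∈ₗ xs → z ∈ₗ ys) → length xs ≤ length ys
unique⊆⇒length≤ {xs = []} _ _ = z≤n
unique⊆⇒length≤ {xs = x ∷ xs} {ys} (x∉xs ∷ xs!) xs⊆ys =
  subst (suc (length xs) ≤_) (sym (length-removeAt′ ys _))
    (s≤s (unique⊆⇒length≤ xs! λ z∈xs →
      ∈-─⁺ x∈ys (xs⊆ys (there z∈xs)) λ z≡x → All.lookup x∉xs z∈xs (sym z≡x)))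
  where x∈ys = xs⊆ys (here refl)

length-concat-map≤ : ∀ {A B : Set} {T} (g : A → List B) → (∀ a → length (g a) ≤ T) →
                     ∀ as → length (concat (map g as)) ≤ length as * T
length-concat-map≤ g g≤T [] = z≤n
length-concat-map≤ g g≤T (a ∷ as) =
  subst (_≤ _) (sym (length-++ (g a))) (+-mono-≤ (g≤T a) (length-concat-map≤ g g≤T as))

module _ {A : Set} {m : ℕ} (f : A → Fin m) where

  fibre : Fin m → List A → List A
  fibre k = filter (λ x → f x Fin.≟ k)

  length≤fibres : ∀ {xs T} → Unique xs → (∀ k → length (fibre k xs) ≤ T) → length xs ≤ m * T
  length≤fibres {xs} {T} xs! fibre≤T = begin
    length xs                                      ≤⟨ unique⊆⇒length≤ xs! x∈fibres ⟩
    length (concat (map (λ k → fibre k xs) (allFin m))) ≤⟨ length-concat-map≤ _ fibre≤T (allFin m) ⟩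
    length (allFin m) * T                          ≡⟨ cong (_* T) (length-tabulate {n = m} (λ k → k)) ⟩
    m * T                                          ∎
    where
    open ≤-Reasoning
    x∈fibres : ∀ {x} → x ∈ₗ xs → x ∈ₗ concat (map (λ k → fibre k xs) (allFin m))
    x∈fibres {x} x∈xs = ∈-concat⁺′ (∈-filter⁺ _ x∈xs refl) (∈-map⁺ (λ k → fibre k xs) (∈-allFin (f x)))

members : ∀ {n} → Subset n → List (Fin n)
members [] = []
members (inside ∷ p) = zero ∷ map suc (members p)
members (outside ∷ p) = map suc (members p)

length-members : ∀ {n} (p : Subset n) → length (members p) ≡ ∣ p ∣
length-members [] = refl
length-members (inside ∷ p) = cong suc (trans (length-map suc (members p)) (length-members p))
length-members (outside ∷ p) = trans (length-map suc (members p)) (length-members p)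

members-unique : ∀ {n} (p : Subset n) → Unique (members p)
members-unique [] = []
members-unique (inside ∷ p) =
  All.tabulate (λ z∈ 0≡z → zero∉suc (subst (_∈ₗ _) (sym 0≡z) z∈)) ∷ Unique.map⁺ Fin.suc-injective (members-unique p)
  where
  zero∉suc : ∀ {n} {xs : List (Fin n)} → zero ∈ₗ map suc xs → ⊥
  zero∉suc {n} z∈ with ∈-map⁻ {A = Fin n} {B = Fin (suc n)} suc z∈
  ... | _ , _ , ()
members-unique (outside ∷ p) = Unique.map⁺ Fin.suc-injective (members-unique p)

∈members⁺ : ∀ {n} {p : Subset n} {x} → x ∈ p → x ∈ₗ members p
∈members⁺ {p = inside ∷ p} here = here refl
∈members⁺ {p = inside ∷ p} (there x∈p) = there (∈-map⁺ suc (∈members⁺ x∈p))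
∈members⁺ {p = outside ∷ p} (there x∈p) = ∈-map⁺ suc (∈members⁺ x∈p)

∈members⁻ : ∀ {n} (p : Subset n) {x} → x ∈ₗ members p → x ∈ p
∈members⁻ (inside ∷ p) (here refl) = here
∈members⁻ (inside ∷ p) (there x∈) with ∈-map⁻ suc x∈
... | _ , y∈ , refl = there (∈members⁻ p y∈)
∈members⁻ (outside ∷ p) x∈ with ∈-map⁻ suc x∈
... | _ , y∈ , refl = there (∈members⁻ p y∈)

unique⊆⇒length≤∣∣ : ∀ {n} {xs : List (Fin n)} (p : Subset n) → Unique xs →
                    (∀ {x} → x ∈ₗ xs → x ∈ p) → length xs ≤ ∣ p ∣
unique⊆⇒length≤∣∣ p xs! xs⊆p =
  subst (_ ≤_) (length-members p) (unique⊆⇒length≤ xs! (∈members⁺ ∘ xs⊆p))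

∣∣-injection : ∀ {n} {p q : Subset n} (f : Fin n → Fin n) → (∀ {x y} → f x ≡ f y → x ≡ y) →
               (∀ {x} → x ∈ p → f x ∈ q) → ∣ p ∣ ≤ ∣ q ∣
∣∣-injection {p = p} {q} f f-inj f[p]⊆q =
  subst (_≤ ∣ q ∣) (trans (length-map f (members p)) (length-members p))
    (unique⊆⇒length≤∣∣ q (Unique.map⁺ f-inj (members-unique p)) f∈q)
  where
  f∈q : ∀ {y} → y ∈ₗ map f (members p) → y ∈ q
  f∈q y∈ with ∈-map⁻ f y∈
  ... | x , x∈ , refl = f[p]⊆q (∈members⁻ p x∈)

∣∣-disjoint : ∀ {n} {p q r : Subset n} → (∀ {x} → x ∈ p → x ∉ q) → p ⊆ r → q ⊆ r →
              ∣ p ∣ + ∣ q ∣ ≤ ∣ r ∣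
∣∣-disjoint {p = p} {q} {r} p∩q=∅ p⊆r q⊆r =
  subst (_≤ ∣ r ∣) (trans (length-++ (members p)) (cong₂ _+_ (length-members p) (length-members q)))
    (unique⊆⇒length≤∣∣ r (Unique.++⁺ (members-unique p) (members-unique q) disjoint) ∈r)
  where
  disjoint : ∀ {x} → x ∈ₗ members p × x ∈ₗ members q → ⊥
  disjoint (x∈p , x∈q) = p∩q=∅ (∈members⁻ p x∈p) (∈members⁻ q x∈q)
  ∈r : ∀ {x} → x ∈ₗ members p ++ members q → x ∈ r
  ∈r x∈ with ∈-++⁻ (members p) x∈
  ... | inj₁ x∈p = p⊆r (∈members⁻ p x∈p)
  ... | inj₂ x∈q = q⊆r (∈members⁻ q x∈q)

subsets : ∀ {n} → Subset n → List (Subset n)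
subsets [] = [ [] ]
subsets (inside ∷ p) = map (inside ∷_) (subsets p) ++ map (outside ∷_) (subsets p)
subsets (outside ∷ p) = map (outside ∷_) (subsets p)

length-subsets : ∀ {n} (p : Subset n) → length (subsets p) ≡ 2 ^ ∣ p ∣
length-subsets [] = refl
length-subsets (inside ∷ p) = begin
  length (map (inside ∷_) (subsets p) ++ map (outside ∷_) (subsets p))
    ≡⟨ length-++ (map (inside ∷_) (subsets p)) ⟩
  length (map (inside ∷_) (subsets p)) + length (map (outside ∷_) (subsets p))
    ≡⟨ cong₂ _+_ (length-map _ (subsets p)) (length-map _ (subsets p)) ⟩
  length (subsets p) + length (subsets p)
    ≡⟨ cong (λ l → l + l) (length-subsets p) ⟩
  2 ^ ∣ p ∣ + 2 ^ ∣ p ∣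
    ≡⟨ cong (2 ^ ∣ p ∣ +_) (sym (+-identityʳ _)) ⟩
  2 ^ suc ∣ p ∣ ∎
  where open ≡-Reasoning
length-subsets (outside ∷ p) = trans (length-map _ (subsets p)) (length-subsets p)

⊆⇒∈subsets : ∀ {n} {p q : Subset n} → q ⊆ p → q ∈ₗ subsets p
⊆⇒∈subsets {p = []} {[]} _ = here refl
⊆⇒∈subsets {p = inside ∷ p} {inside ∷ q} q⊆p =
  ∈-++⁺ˡ (∈-map⁺ (inside ∷_) (⊆⇒∈subsets (drop-∷-⊆ q⊆p)))
⊆⇒∈subsets {p = inside ∷ p} {outside ∷ q} q⊆p =
  ∈-++⁺ʳ _ (∈-map⁺ (outside ∷_) (⊆⇒∈subsets (drop-∷-⊆ q⊆p)))
⊆⇒∈subsets {p = outside ∷ p} {inside ∷ q} q⊆p with q⊆p here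
... | ()
⊆⇒∈subsets {p = outside ∷ p} {outside ∷ q} q⊆p = ∈-map⁺ (outside ∷_) (⊆⇒∈subsets (drop-∷-⊆ q⊆p))

unique-subsets-length≤ : ∀ {n} {L : List (Subset n)} (p : Subset n) → Unique L →
                         (∀ {S} → S ∈ₗ L → S ⊆ p) → length L ≤ 2 ^ ∣ p ∣
unique-subsets-length≤ p L! L⊆p =
  subst (_ ≤_) (length-subsets p) (unique⊆⇒length≤ L! (⊆⇒∈subsets ∘ L⊆p))

unique-family-length≤ : ∀ {n m} {F : List (Subset n)} (Y : Subset n → Subset n) → Unique F →
                        (∀ {S S′} → S ∈ₗ F → S′ ∈ₗ F → S ⊆ Y S′) → (∀ {S} → S ∈ₗ F → ∣ Y S ∣ ≤ m) →
                        length F ≤ 2 ^ m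
unique-family-length≤ {F = []} _ _ _ _ = z≤n
unique-family-length≤ {F = S₀ ∷ F} Y F! F⊆Y ∣Y∣≤m =
  ≤-trans (unique-subsets-length≤ (Y S₀) F! (λ S∈F → F⊆Y S∈F (here refl))) (^-monoʳ-≤ 2 (∣Y∣≤m (here refl)))

subsetOf : ∀ {n} {P : Fin n → Set} → (∀ x → Dec (P x)) → Subset n
subsetOf {zero} P? = []
subsetOf {suc n} P? = does (P? zero) ∷ subsetOf (P? ∘ suc)

∈subsetOf⁺ : ∀ {n} {P : Fin n → Set} (P? : ∀ x → Dec (P x)) {x} → P x → x ∈ subsetOf P?
∈subsetOf⁺ P? {zero} Px with P? zero
... | yes _ = here
... | no ¬Px = ⊥-elim (¬Px Px)
∈subsetOf⁺ P? {suc x} Px = there (∈subsetOf⁺ (P? ∘ suc) Px)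

∈subsetOf⁻ : ∀ {n} {P : Fin n → Set} (P? : ∀ x → Dec (P x)) {x} → x ∈ subsetOf P? → P x
∈subsetOf⁻ P? {zero} x∈ with P? zero | x∈
... | yes Px | _ = Px
... | no _ | ()
∈subsetOf⁻ P? {suc x} (there x∈) = ∈subsetOf⁻ (P? ∘ suc) x∈

module _ {n : ℕ} (G : FinAbGroup n) where

  open FinAbGroup G
  open IsAbelianGroup isAbelianGroup using (assoc; comm; identityˡ; identityʳ; inverseˡ)

  abelianGroup : AbelianGroup 0ℓ 0ℓ
  abelianGroup = record { isAbelianGroup = isAbelianGroup }

  open import Algebra.Properties.AbelianGroup abelianGroup
    using (∙-cancelˡ; ∙-cancelʳ; ⁻¹-∙-comm; inverseʳ-unique; ε⁻¹≈ε; //-rightDividesʳ; \\-leftDividesʳ)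
  open AbelianGroup abelianGroup using (commutativeMonoid; commutativeSemigroup)
  open import Algebra.Properties.CommutativeSemigroup commutativeSemigroup using (interchange)
  open import Algebra.Properties.CommutativeMonoid.Mult commutativeMonoid
    using (×-homo-+; ×-homo-1; ×-assocˡ) renaming (_×_ to _·_)

  ·-inverse : ∀ a {j m} → j ≤ m → m · a ≡ ε → (j · a) ⁻¹ ≡ (m ∸ j) · a
  ·-inverse a {j} {m} j≤m m·a≡ε = sym (inverseʳ-unique (j · a) ((m ∸ j) · a) (begin
    (j · a) ∙ ((m ∸ j) · a)   ≡⟨ ×-homo-+ a j (m ∸ j) ⟨
    (j + (m ∸ j)) · a         ≡⟨ cong (_· a) (m+[n∸m]≡n j≤m) ⟩
    m · a                     ≡⟨ m·a≡ε ⟩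
    ε                         ∎))
    where open ≡-Reasoning

  period : ∀ a → ∃[ r ] 0 < r × r ≤ n × r · a ≡ ε
  period a with Fin.pigeonhole (n<1+n n) (λ i → toℕ i · a)
  ... | i , j , i<j , i·a≡j·a = toℕ j ∸ toℕ i , m<n⇒0<n∸m i<j , r≤n , r·a≡ε
    where
    r≤n : toℕ j ∸ toℕ i ≤ n
    r≤n = ≤-trans (m∸n≤m (toℕ j) (toℕ i)) (Fin.toℕ≤pred[n] j)
    r·a≡ε : (toℕ j ∸ toℕ i) · a ≡ ε
    r·a≡ε = ∙-cancelˡ (toℕ i · a) _ ε (begin
      (toℕ i · a) ∙ ((toℕ j ∸ toℕ i) · a)   ≡⟨ ×-homo-+ a (toℕ i) _ ⟨
      (toℕ i + (toℕ j ∸ toℕ i)) · a          ≡⟨ cong (_· a) (m+[n∸m]≡n (<⇒≤ i<j)) ⟩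
      toℕ j · a                              ≡⟨ i·a≡j·a ⟨
      toℕ i · a                              ≡⟨ identityʳ _ ⟨
      (toℕ i · a) ∙ ε                        ∎)
      where open ≡-Reasoning

  ·-divMod : ∀ a m k .{{_ : NonZero k}} → m · a ≡ ((m % k) · a) ∙ ((m / k) · (k · a))
  ·-divMod a m k = begin
    m · a                                   ≡⟨ cong (_· a) (m≡m%n+[m/n]*n m k) ⟩
    (m % k + m / k * k) · a                 ≡⟨ ×-homo-+ a (m % k) _ ⟩
    ((m % k) · a) ∙ ((m / k * k) · a)       ≡⟨ cong (((m % k) · a) ∙_) (×-assocˡ a (m / k) k) ⟨
    ((m % k) · a) ∙ ((m / k) · (k · a))     ∎
    where open ≡-Reasoning

  interchange-· : ∀ h h′ a i j → (h ∙ (i · a)) ∙ (h′ ∙ (j · a)) ≡ (h ∙ h′) ∙ ((i + j) · a)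
  interchange-· h h′ a i j = trans (interchange h (i · a) h′ (j · a)) (cong ((h ∙ h′) ∙_) (sym (×-homo-+ a i j)))

  module _ {K : Subset n} (K≤G : IsSubgroup G K) where

    ∙∈⁻ˡ : ∀ {x y} → x ∙ y ∈ K → y ∈ K → x ∈ K
    ∙∈⁻ˡ {x} {y} xy∈K y∈K = subst (_∈ K) (//-rightDividesʳ y x) (proj₁ (proj₂ K≤G) _ _ xy∈K (proj₂ (proj₂ K≤G) y y∈K))

    -- Translation by a maps K into its complement.
    proper⇒∣K∣+∣K∣≤n : ∀ {a} → a ∉ K → ∣ K ∣ + ∣ K ∣ ≤ n
    proper⇒∣K∣+∣K∣≤n {a} a∉K = begin
      ∣ K ∣ + ∣ K ∣        ≤⟨ +-monoʳ-≤ ∣ K ∣ (∣∣-injection (a ∙_) (∙-cancelˡ a _ _) a∙K⊆∁K) ⟩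
      ∣ K ∣ + ∣ ∁ K ∣      ≤⟨ ∣∣-disjoint {p = K} {∁ K} {⊤} (λ x∈K x∈∁K → x∈∁p⇒x∉p x∈∁K x∈K) ⊆⊤ ⊆⊤ ⟩
      ∣ ⊤ {n} ∣            ≡⟨ ∣⊤∣≡n n ⟩
      n                    ∎
      where
      open ≤-Reasoning
      a∙K⊆∁K : ∀ {x} → x ∈ K → a ∙ x ∈ ∁ K
      a∙K⊆∁K x∈K = x∉p⇒x∈∁p λ ax∈K → a∉K (∙∈⁻ˡ ax∈K x∈K)

  module _ {B : Subset n} (B≤G : IsSubgroup G B) (2∣B∣≡n : 2 * ∣ B ∣ ≡ n) where

    x∉B∧y∉B⇒x⁻¹y∈B : ∀ {x y} → x ∉ B → y ∉ B → (x ⁻¹) ∙ y ∈ B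
    x∉B∧y∉B⇒x⁻¹y∈B {x} {y} x∉B y∉B with (x ⁻¹) ∙ y ∈? B
    ... | yes x⁻¹y∈B = x⁻¹y∈B
    ... | no x⁻¹y∉B = ⊥-elim (<-irrefl refl (begin-strict
      ∣ B ∣                ≤⟨ ∣∣-injection (x ∙_) (∙-cancelˡ x _ _) x∙B⊆∁B-y ⟩
      ∣ ∁ B - y ∣          <⟨ x∈p⇒∣p-x∣<∣p∣ (x∉p⇒x∈∁p y∉B) ⟩
      ∣ ∁ B ∣              ≤⟨ ∣∁B∣≤∣B∣ ⟩
      ∣ B ∣                ∎))
      where
      open ≤-Reasoning
      x∙B⊆∁B-y : ∀ {z} → z ∈ B → x ∙ z ∈ ∁ B - y
      x∙B⊆∁B-y {z} z∈B = x∈p∧x≢y⇒x∈p-y (x∉p⇒x∈∁p λ xz∈B → x∉B (∙∈⁻ˡ B≤G xz∈B z∈B)) λ xz≡y →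
        x⁻¹y∉B (subst (_∈ B) (trans (sym (\\-leftDividesʳ x z)) (cong ((x ⁻¹) ∙_) xz≡y)) z∈B)
      ∣∁B∣≤∣B∣ : ∣ ∁ B ∣ ≤ ∣ B ∣
      ∣∁B∣≤∣B∣ = +-cancelˡ-≤ ∣ B ∣ _ _ (begin
        ∣ B ∣ + ∣ ∁ B ∣    ≤⟨ ∣∣-disjoint {p = B} {∁ B} {⊤} (λ z∈B z∈∁B → x∈∁p⇒x∉p z∈∁B z∈B) ⊆⊤ ⊆⊤ ⟩
        ∣ ⊤ {n} ∣          ≡⟨ trans (∣⊤∣≡n n) (sym 2∣B∣≡n) ⟩
        2 * ∣ B ∣          ≡⟨ cong (∣ B ∣ +_) (+-identityʳ ∣ B ∣) ⟩
        ∣ B ∣ + ∣ B ∣      ∎)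

    -- K ∖ B embeds into K ∩ B (by translation), and K ∪ aK has at most n elements.
    4∣K∖B∣≤n : ∀ {K : Subset n} {a} → IsSubgroup G K → a ∉ K → 4 * ∣ K ∩ ∁ B ∣ ≤ n
    4∣K∖B∣≤n {K} {a} K≤G a∉K = begin
      4 * ∣ K ∩ ∁ B ∣                                        ≡⟨ double-double ∣ K ∩ ∁ B ∣ ⟩
      (∣ K ∩ ∁ B ∣ + ∣ K ∩ ∁ B ∣) + (∣ K ∩ ∁ B ∣ + ∣ K ∩ ∁ B ∣)
        ≤⟨ +-mono-≤ (+-monoʳ-≤ ∣ K ∩ ∁ B ∣ ∣K∖B∣≤∣K∩B∣) (+-monoʳ-≤ ∣ K ∩ ∁ B ∣ ∣K∖B∣≤∣K∩B∣) ⟩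
      (∣ K ∩ ∁ B ∣ + ∣ K ∩ B ∣) + (∣ K ∩ ∁ B ∣ + ∣ K ∩ B ∣)   ≤⟨ +-mono-≤ ∣K∖B∣+∣K∩B∣≤∣K∣ ∣K∖B∣+∣K∩B∣≤∣K∣ ⟩
      ∣ K ∣ + ∣ K ∣                                            ≤⟨ proper⇒∣K∣+∣K∣≤n K≤G a∉K ⟩
      n                                                        ∎
      where
      open ≤-Reasoning
      double-double : ∀ m → 4 * m ≡ (m + m) + (m + m)
      double-double = solve-∀
      ∣K∖B∣+∣K∩B∣≤∣K∣ : ∣ K ∩ ∁ B ∣ + ∣ K ∩ B ∣ ≤ ∣ K ∣
      ∣K∖B∣+∣K∩B∣≤∣K∣ = ∣∣-disjoint (λ x∈K∖B x∈K∩B → x∈∁p⇒x∉p (proj₂ (x∈p∩q⁻ K _ x∈K∖B)) (proj₂ (x∈p∩q⁻ K B x∈K∩B)))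
                          (p∩q⊆p K _) (p∩q⊆p K B)
      ∣K∖B∣≤∣K∩B∣ : ∣ K ∩ ∁ B ∣ ≤ ∣ K ∩ B ∣
      ∣K∖B∣≤∣K∩B∣ with nonempty? (K ∩ ∁ B)
      ... | no K∖B=∅ = subst (_≤ ∣ K ∩ B ∣) (sym (trans (cong ∣_∣ (Empty-unique K∖B=∅)) (∣⊥∣≡0 n))) z≤n
      ... | yes (v , v∈K∖B) = ∣∣-injection ((v ⁻¹) ∙_) (∙-cancelˡ (v ⁻¹) _ _) v⁻¹∙[K∖B]⊆K∩B
        where
        v⁻¹∙[K∖B]⊆K∩B : ∀ {x} → x ∈ K ∩ ∁ B → (v ⁻¹) ∙ x ∈ K ∩ B
        v⁻¹∙[K∖B]⊆K∩B x∈K∖B =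
          let v∈K , v∈∁B = x∈p∩q⁻ K _ v∈K∖B
              x∈K , x∈∁B = x∈p∩q⁻ K _ x∈K∖B
          in x∈p∩q⁺ ( proj₁ (proj₂ K≤G) _ _ (proj₂ (proj₂ K≤G) _ v∈K) x∈K
                    , x∉B∧y∉B⇒x⁻¹y∈B (x∈∁p⇒x∉p v∈∁B) (x∈∁p⇒x∉p x∈∁B))

  N : ℕ
  N = n !

  instance
    N≢0 : NonZero N
    N≢0 = n !≢0

  open Modulo N

  record Subgroup : Set₁ where
    field
      member : Fin n → Set
      member? : ∀ x → Dec (member x)
      ε-member : member ε
      ∙-member : ∀ {x y} → member x → member y → member (x ∙ y)
      ⁻¹-member : ∀ {x} → member x → member (x ⁻¹)

    ·-member : ∀ {x} j → member x → member (j · x)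
    ·-member zero _ = ε-member
    ·-member (suc j) x∈ = ∙-member x∈ (·-member j x∈)

    ∙-member⁻ˡ : ∀ {x y} → member (x ∙ y) → member y → member x
    ∙-member⁻ˡ {x} {y} xy∈ y∈ = subst member (//-rightDividesʳ y x) (∙-member xy∈ (⁻¹-member y∈))

  open Subgroup using (member; member?; ε-member; ∙-member; ⁻¹-member; ·-member; ∙-member⁻ˡ)

  record RelativeOrder (H : Subgroup) (a : Fin n) : Set where
    field
      k : ℕ
      k≢0 : NonZero k
      k·a∈H : member H (k · a)
      minimal : ∀ {d} → d < k → member H (d · a) → d ≡ 0

    instance
      k-nonZero : NonZero k
      k-nonZero = k≢0

    member⇒k∣ : ∀ {m} → member H (m · a) → k ∣ m
    member⇒k∣ {m} m·a∈H = m%n≡0⇒n∣m m k (minimal (m%n<n m k)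
      (∙-member⁻ˡ H (subst (member H) (·-divMod a m k) m·a∈H) (·-member H (m / k) k·a∈H)))

    multiple-period : ∃[ q ] NonZero q × q * k ∣ N × (q * k) · a ≡ ε
    multiple-period with period a
    ... | r , 0<r , r≤n , r·a≡ε =
      r / k , q≢0 , subst (_∣ N) (sym qk≡r) (m≤n⇒m∣n! 0<r r≤n) , trans (cong (_· a) qk≡r) r·a≡ε
      where
      k∣r : k ∣ r
      k∣r = member⇒k∣ (subst (member H) (sym r·a≡ε) (ε-member H))
      qk≡r : r / k * k ≡ r
      qk≡r = m/n*n≡m k∣r
      q≢0 : NonZero (r / k)
      q≢0 = >-nonZero (m≥n⇒m/n>0 (∣⇒≤ {{>-nonZero 0<r}} k∣r))

    k∣N : k ∣ N
    k∣N with multiple-period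
    ... | q , _ , qk∣N , _ = ∣-trans (n∣m*n q) qk∣N

    u : ℕ
    u = N / k

    N≡k*u : N ≡ k * u
    N≡k*u = sym (m*[n/m]≡n k∣N)

    instance
      u≢0 : NonZero u
      u≢0 = >-nonZero (m≥n⇒m/n>0 (∣⇒≤ k∣N))

  relativeOrder : (H : Subgroup) (a : Fin n) → RelativeOrder H a
  relativeOrder H a with period a
  ... | suc r , _ , _ , r·a≡ε with least (λ d → member? H (suc d · a)) {r} (subst (member H) (sym r·a≡ε) (ε-member H))
  ...   | d , k·a∈H , below = record { k = suc d ; k≢0 = _ ; k·a∈H = k·a∈H ; minimal = minimal }
    where
    minimal : ∀ {j} → j < suc d → member H (j · a) → j ≡ 0
    minimal {zero} _ _ = refl
    minimal {suc j} (s≤s j<d) j·a∈H = ⊥-elim (below j<d j·a∈H)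

  module Join {H : Subgroup} {a : Fin n} (o : RelativeOrder H a) where

    open RelativeOrder o public

    NormalForm : Fin n → Set
    NormalForm x = ∃[ i ] ∃[ h ] member H h × x ≡ h ∙ (toℕ {k} i · a)

    normalForm? : ∀ x → Dec (NormalForm x)
    normalForm? x = Fin.any? λ i → Fin.any? λ h → member? H h ×-dec (x Fin.≟ h ∙ (toℕ i · a))

    normalForm : ∀ {h} → member H h → ∀ j → NormalForm (h ∙ (j · a))
    normalForm {h} h∈H j = fromℕ< j%k<k , h₁ , ∙-member H h∈H (·-member H (j / k) k·a∈H) , (begin
      h ∙ (j · a)                                   ≡⟨ cong (h ∙_) (trans (·-divMod a j k) (comm _ _)) ⟩
      h ∙ (((j / k) · (k · a)) ∙ ((j % k) · a))     ≡⟨ assoc h _ _ ⟨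
      h₁ ∙ ((j % k) · a)                            ≡⟨ cong (λ m → h₁ ∙ (m · a)) (Fin.toℕ-fromℕ< j%k<k) ⟨
      h₁ ∙ (toℕ (fromℕ< j%k<k) · a)                 ∎)
      where
      open ≡-Reasoning
      j%k<k = m%n<n j k
      h₁ = h ∙ ((j / k) · (k · a))

    private
      normalForm-unique≤ : ∀ {h h′ i i′} → member H h → member H h′ → i ≤ i′ → i′ < k →
                           h ∙ (i · a) ≡ h′ ∙ (i′ · a) → h ≡ h′ × i ≡ i′
      normalForm-unique≤ {h} {h′} {i} {i′} h∈H h′∈H i≤i′ i′<k eq = h≡h′ , i≡i′
        where
        d = i′ ∸ i
        h≡h′∙d·a : h ≡ h′ ∙ (d · a)
        h≡h′∙d·a = ∙-cancelʳ (i · a) h (h′ ∙ (d · a)) (begin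
          h ∙ (i · a)                 ≡⟨ eq ⟩
          h′ ∙ (i′ · a)               ≡⟨ cong (λ m → h′ ∙ (m · a)) (trans (sym (m+[n∸m]≡n i≤i′)) (+-comm i d)) ⟩
          h′ ∙ ((d + i) · a)          ≡⟨ cong (h′ ∙_) (×-homo-+ a d i) ⟩
          h′ ∙ ((d · a) ∙ (i · a))    ≡⟨ assoc h′ _ _ ⟨
          (h′ ∙ (d · a)) ∙ (i · a)    ∎)
          where open ≡-Reasoning
        d≡0 : d ≡ 0
        d≡0 = minimal (≤-<-trans (m∸n≤m i′ i) i′<k)
                (∙-member⁻ˡ H (subst (member H) (trans h≡h′∙d·a (comm h′ _)) h∈H) h′∈H)
        h≡h′ : h ≡ h′
        h≡h′ = trans h≡h′∙d·a (trans (cong (λ m → h′ ∙ (m · a)) d≡0) (identityʳ h′))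
        i≡i′ : i ≡ i′
        i≡i′ = trans (sym (+-identityʳ i)) (trans (cong (i +_) (sym d≡0)) (m+[n∸m]≡n i≤i′))

    normalForm-unique : ∀ {h h′ i i′} → member H h → member H h′ → i < k → i′ < k →
                        h ∙ (i · a) ≡ h′ ∙ (i′ · a) → h ≡ h′ × i ≡ i′
    normalForm-unique {i = i} {i′} h∈H h′∈H i<k i′<k eq with ≤-total i i′
    ... | inj₁ i≤i′ = normalForm-unique≤ h∈H h′∈H i≤i′ i′<k eq
    ... | inj₂ i′≤i = Product.map sym sym (normalForm-unique≤ h′∈H h∈H i′≤i i<k (sym eq))

    join : Subgroup
    join = record
      { member = NormalForm
      ; member? = normalForm?
      ; ε-member = subst NormalForm (identityʳ ε) (normalForm (ε-member H) 0)
      ; ∙-member = λ { (i , h , h∈H , refl) (i′ , h′ , h′∈H , refl) →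
          subst NormalForm (sym (interchange-· h h′ a (toℕ i) (toℕ i′)))
            (normalForm (∙-member H h∈H h′∈H) (toℕ i + toℕ i′)) }
      ; ⁻¹-member = λ { (i , h , h∈H , refl) → inverse-normalForm h∈H i }
      }
      where
      inverse-normalForm : ∀ {h} → member H h → (i : Fin k) → NormalForm ((h ∙ (toℕ i · a)) ⁻¹)
      inverse-normalForm {h} h∈H i with multiple-period
      ... | q , q≢0 , _ , qk·a≡ε = subst NormalForm inverse (normalForm (⁻¹-member H h∈H) (q * k ∸ toℕ i))
        where
        i≤qk : toℕ i ≤ q * k
        i≤qk = ≤-trans (<⇒≤ (Fin.toℕ<n i)) (m≤n*m k q {{q≢0}})
        inverse : (h ⁻¹) ∙ ((q * k ∸ toℕ i) · a) ≡ (h ∙ (toℕ i · a)) ⁻¹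
        inverse = trans (cong ((h ⁻¹) ∙_) (sym (·-inverse a i≤qk qk·a≡ε))) (⁻¹-∙-comm h _)

    H⊆join : ∀ {h} → member H h → NormalForm h
    H⊆join {h} h∈H = subst NormalForm (identityʳ h) (normalForm h∈H 0)

    a∈join : NormalForm a
    a∈join = subst NormalForm (trans (identityˡ _) (×-homo-1 a)) (normalForm (ε-member H) 1)

  -- Characters take values in ℤ/N, represented by natural numbers read modulo N = n!.
  record PartialCharacter : Set₁ where
    field
      domain : Subgroup
      χ : Fin n → ℕ
      χ-∙ : ∀ {x y} → member domain x → member domain y → χ (x ∙ y) ≋ χ x + χ y

    χ-ε : χ ε ≋ 0
    χ-ε = +-cancelˡ-≋ (χ ε) (begin
      χ ε + χ ε     ≈⟨ χ-∙ (ε-member domain) (ε-member domain) ⟨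
      χ (ε ∙ ε)     ≡⟨ cong χ (identityʳ ε) ⟩
      χ ε           ≡⟨ +-identityʳ (χ ε) ⟨
      χ ε + 0       ∎)
      where open SetoidReasoning ≋-setoid

    χ-· : ∀ {x} → member domain x → ∀ j → χ (j · x) ≋ j * χ x
    χ-· x∈ zero = χ-ε
    χ-· {x} x∈ (suc j) = trans (χ-∙ x∈ (·-member domain j x∈)) (+-congˡ-≋ (χ x) (χ-· x∈ j))

  open PartialCharacter using (domain; χ; χ-∙; χ-ε; χ-·)

  -- By uniqueness of normal forms φ′ (h ∙ i · a) = φ h + i c is well defined on H⟨a⟩ (the value 0
  -- elsewhere is never used), and it is a homomorphism as soon as k c ≋ φ (k · a).
  module Extension (P : PartialCharacter) {a : Fin n} (o : RelativeOrder (domain P) a) where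

    open Join o
    private
      H = domain P
      φ = χ P

    module _ (c : ℕ) where

      φ′ : Fin n → ℕ
      φ′ x with normalForm? x
      ... | yes (i , h , _) = φ h + toℕ i * c
      ... | no _ = 0

      φ′-normalForm : ∀ {x} (nf : NormalForm x) → φ′ x ≡ φ (proj₁ (proj₂ nf)) + toℕ (proj₁ nf) * c
      φ′-normalForm {x} (i , h , h∈H , x≡) with normalForm? x
      ... | no ¬nf = ⊥-elim (¬nf (i , h , h∈H , x≡))
      ... | yes (i₀ , h₀ , h₀∈H , x≡₀) with normalForm-unique h₀∈H h∈H (Fin.toℕ<n i₀) (Fin.toℕ<n i) (trans (sym x≡₀) x≡)
      ...   | h₀≡h , i₀≡i = cong₂ (λ g m → φ g + m * c) h₀≡h i₀≡i

      module _ (kc≋φ[k·a] : k * c ≋ φ (k · a)) where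

        φ′-· : ∀ {h} → member H h → ∀ j → φ′ (h ∙ (j · a)) ≋ φ h + j * c
        φ′-· {h} h∈H j = begin
          φ′ (h ∙ (j · a))                        ≡⟨ φ′-normalForm (normalForm h∈H j) ⟩
          φ h₁ + toℕ (fromℕ< (m%n<n j k)) * c     ≡⟨ cong (λ m → φ h₁ + m * c) (Fin.toℕ-fromℕ< (m%n<n j k)) ⟩
          φ h₁ + r * c                            ≈⟨ +-congʳ-≋ (r * c) (χ-∙ P h∈H (·-member H q k·a∈H)) ⟩
          (φ h + φ (q · (k · a))) + r * c         ≈⟨ +-congʳ-≋ (r * c) (+-congˡ-≋ (φ h) (χ-· P k·a∈H q)) ⟩
          (φ h + q * φ (k · a)) + r * c           ≈⟨ +-congʳ-≋ (r * c) (+-congˡ-≋ (φ h) (*-congˡ-≋ q kc≋φ[k·a])) ⟨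
          (φ h + q * (k * c)) + r * c             ≡⟨ collect (φ h) q k c r ⟩
          φ h + (r + q * k) * c                   ≡⟨ cong (λ m → φ h + m * c) (m≡m%n+[m/n]*n j k) ⟨
          φ h + j * c                             ∎
          where
          open SetoidReasoning ≋-setoid
          q = j / k
          r = j % k
          h₁ = h ∙ (q · (k · a))
          collect : ∀ A q k c r → (A + q * (k * c)) + r * c ≡ A + (r + q * k) * c
          collect = solve-∀

        extension : PartialCharacter
        extension = record
          { domain = join
          ; χ = φ′
          ; χ-∙ = λ { (i , h , h∈H , refl) (i′ , h′ , h′∈H , refl) → begin
              φ′ ((h ∙ (toℕ i · a)) ∙ (h′ ∙ (toℕ i′ · a)))     ≡⟨ cong φ′ (interchange-· h h′ a (toℕ i) (toℕ i′)) ⟩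
              φ′ ((h ∙ h′) ∙ ((toℕ i + toℕ i′) · a))           ≈⟨ φ′-· (∙-member H h∈H h′∈H) (toℕ i + toℕ i′) ⟩
              φ (h ∙ h′) + (toℕ i + toℕ i′) * c                ≈⟨ +-congʳ-≋ ((toℕ i + toℕ i′) * c) (χ-∙ P h∈H h′∈H) ⟩
              (φ h + φ h′) + (toℕ i + toℕ i′) * c              ≡⟨ regroup (φ h) (φ h′) (toℕ i) (toℕ i′) c ⟩
              (φ h + toℕ i * c) + (φ h′ + toℕ i′ * c)
                ≡⟨ cong₂ _+_ (φ′-normalForm (i , h , h∈H , refl)) (φ′-normalForm (i′ , h′ , h′∈H , refl)) ⟨
              φ′ (h ∙ (toℕ i · a)) + φ′ (h′ ∙ (toℕ i′ · a))    ∎ }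
          }
          where
          open SetoidReasoning ≋-setoid
          regroup : ∀ A B i i′ c → (A + B) + (i + i′) * c ≡ (A + i * c) + (B + i′ * c)
          regroup = solve-∀

        extension-agrees : ∀ {h} → member H h → φ′ h ≋ φ h
        extension-agrees {h} h∈H = begin
          φ′ h               ≡⟨ cong φ′ (identityʳ h) ⟨
          φ′ (h ∙ (0 · a))   ≈⟨ φ′-· h∈H 0 ⟩
          φ h + 0            ≡⟨ +-identityʳ (φ h) ⟩
          φ h                ∎
          where open SetoidReasoning ≋-setoid

        extension-at-a : φ′ a ≋ c
        extension-at-a = begin
          φ′ a               ≡⟨ cong φ′ (trans (identityˡ _) (×-homo-1 a)) ⟨
          φ′ (ε ∙ (1 · a))   ≈⟨ φ′-· (ε-member H) 1 ⟩
          φ ε + 1 * c        ≈⟨ +-congʳ-≋ (1 * c) (χ-ε P) ⟩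
          1 * c              ≡⟨ *-identityˡ c ⟩
          c                  ∎
          where open SetoidReasoning ≋-setoid

    solution : ∃[ c ] k * c ≋ φ (k · a)
    solution with multiple-period
    ... | q , q≢0 , qk∣N , qk·a≡ε = φ (k · a) % N / k , k*[t%N/k]≋t q k (φ (k · a)) {{q≢0}} qk∣N q*t≋0
      where
      q*t≋0 : q * φ (k · a) ≋ 0
      q*t≋0 = begin
        q * φ (k · a)      ≈⟨ χ-· P k·a∈H q ⟨
        φ (q · (k · a))    ≡⟨ cong φ (trans (×-assocˡ a q k) qk·a≡ε) ⟩
        φ ε                ≈⟨ χ-ε P ⟩
        0                  ∎
        where open SetoidReasoning ≋-setoid

  extendBy : PartialCharacter → Fin n → PartialCharacter
  extendBy P a = extension (proj₁ solution) (proj₂ solution)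
    where open Extension P (relativeOrder (domain P) a)

  module _ (P : PartialCharacter) (a : Fin n) where
    open Join (relativeOrder (domain P) a) using (H⊆join; a∈join)
    open Extension P (relativeOrder (domain P) a) using (extension-agrees; solution)

    extendBy-⊇ : ∀ {x} → member (domain P) x → member (domain (extendBy P a)) x
    extendBy-⊇ = H⊆join

    extendBy-∋ : member (domain (extendBy P a)) a
    extendBy-∋ = a∈join

    extendBy-agrees : ∀ {x} → member (domain P) x → χ (extendBy P a) x ≋ χ P x
    extendBy-agrees = extension-agrees (proj₁ solution) (proj₂ solution)

  extendAlong : PartialCharacter → List (Fin n) → PartialCharacter
  extendAlong P [] = P
  extendAlong P (a ∷ as) = extendBy (extendAlong P as) a

  extendAlong-⊇ : ∀ P as {x} → member (domain P) x → member (domain (extendAlong P as)) x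
  extendAlong-⊇ P [] x∈ = x∈
  extendAlong-⊇ P (a ∷ as) x∈ = extendBy-⊇ (extendAlong P as) a (extendAlong-⊇ P as x∈)

  extendAlong-∋ : ∀ P as {x} → x ∈ₗ as → member (domain (extendAlong P as)) x
  extendAlong-∋ P (a ∷ as) (here refl) = extendBy-∋ (extendAlong P as) a
  extendAlong-∋ P (a ∷ as) (there x∈as) = extendBy-⊇ (extendAlong P as) a (extendAlong-∋ P as x∈as)

  extendAlong-agrees : ∀ P as {x} → member (domain P) x → χ (extendAlong P as) x ≋ χ P x
  extendAlong-agrees P [] x∈ = refl
  extendAlong-agrees P (a ∷ as) x∈ =
    trans (extendBy-agrees (extendAlong P as) a (extendAlong-⊇ P as x∈)) (extendAlong-agrees P as x∈)

  record Character : Set₁ where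
    field
      partial : PartialCharacter
      total : ∀ x → member (domain partial) x

    χ-∙-· : ∀ h x i → χ partial (h ∙ (i · x)) ≋ χ partial h + i * χ partial x
    χ-∙-· h x i = trans (χ-∙ partial (total h) (total (i · x))) (+-congˡ-≋ (χ partial h) (χ-· partial (total x) i))

  open Character using (partial; total; χ-∙-·)

  extendToCharacter : PartialCharacter → Character
  extendToCharacter P = record
    { partial = extendAlong P (allFin n)
    ; total = λ x → extendAlong-∋ P (allFin n) (∈-allFin x)
    }

  trivial : Subgroup
  trivial = record
    { member = _≡ ε
    ; member? = Fin._≟ ε
    ; ε-member = refl
    ; ∙-member = λ { refl refl → identityʳ ε }
    ; ⁻¹-member = λ { refl → ε⁻¹≈ε }
    }

  span : List (Fin n) → Subgroup
  span [] = trivial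
  span (x ∷ xs) = Join.join (relativeOrder (span xs) x)

  span-∋ : ∀ {xs x} → x ∈ₗ xs → member (span xs) x
  span-∋ {x ∷ xs} (here refl) = Join.a∈join (relativeOrder (span xs) x)
  span-∋ {y ∷ xs} (there x∈xs) = Join.H⊆join (relativeOrder (span xs) y) (span-∋ x∈xs)

  Gen-· : ∀ {S x} → Gen G S x → ∀ j → Gen G S (j · x)
  Gen-· _ zero = unit
  Gen-· x∈⟨S⟩ (suc j) = mul x∈⟨S⟩ (Gen-· x∈⟨S⟩ j)

  span⊆Gen : ∀ {S} xs → (∀ {x} → x ∈ₗ xs → Gen G S x) → ∀ {y} → member (span xs) y → Gen G S y
  span⊆Gen [] _ refl = unit
  span⊆Gen (x ∷ xs) xs⊆⟨S⟩ (i , h , h∈span , refl) =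
    mul (span⊆Gen xs (xs⊆⟨S⟩ ∘ there) h∈span) (Gen-· (xs⊆⟨S⟩ (here refl)) (toℕ i))

  -- The code of χ is ∏ x ^ (digit of x) with digits ⌊(χ x mod N) / u⌋ < k, where N = k u. It determines χ:
  -- k χ x = χ (k · x) is determined by the code on the shorter list and fixes χ x mod u, and the digit
  -- supplies the rest of χ x mod N.
  digit : PartialCharacter → List (Fin n) → Fin n → ℕ
  digit P xs x = χ P x % N / u
    where open RelativeOrder (relativeOrder (span xs) x)

  code : PartialCharacter → List (Fin n) → Fin n
  code P [] = ε
  code P (x ∷ xs) = code P xs ∙ (digit P xs x · x)

  digit< : ∀ P xs x → digit P xs x < RelativeOrder.k (relativeOrder (span xs) x)
  digit< P xs x = m<n*o⇒m/o<n (subst (χ P x % N <_) N≡k*u (m%n<n (χ P x) N))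
    where open RelativeOrder (relativeOrder (span xs) x)

  code∈span : ∀ P xs → member (span xs) (code P xs)
  code∈span P [] = refl
  code∈span P (x ∷ xs) = Join.normalForm (relativeOrder (span xs) x) (code∈span P xs) (digit P xs x)

  code-injective : ∀ (X Y : Character) xs → code (partial X) xs ≡ code (partial Y) xs →
                   ∀ {y} → member (span xs) y → χ (partial X) y ≋ χ (partial Y) y
  code-injective X Y [] _ refl = trans (χ-ε (partial X)) (sym (χ-ε (partial Y)))
  code-injective X Y (x ∷ xs) codes≡ (i , h , h∈span , refl) = begin
    φ (h ∙ (toℕ i · x))     ≈⟨ χ-∙-· X h x (toℕ i) ⟩
    φ h + toℕ i * φ x       ≈⟨ +-cong-≋ (agree-on-span h∈span) (*-congˡ-≋ (toℕ i) agree-at-x) ⟩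
    ψ h + toℕ i * ψ x       ≈⟨ χ-∙-· Y h x (toℕ i) ⟨
    ψ (h ∙ (toℕ i · x))     ∎
    where
    open Join (relativeOrder (span xs) x)
    open SetoidReasoning ≋-setoid
    φ = χ (partial X)
    ψ = χ (partial Y)
    tails≡∧digits≡ : code (partial X) xs ≡ code (partial Y) xs × digit (partial X) xs x ≡ digit (partial Y) xs x
    tails≡∧digits≡ = normalForm-unique (code∈span (partial X) xs) (code∈span (partial Y) xs)
                       (digit< (partial X) xs x) (digit< (partial Y) xs x) codes≡
    agree-on-span : ∀ {y} → member (span xs) y → φ y ≋ ψ y
    agree-on-span = code-injective X Y xs (proj₁ tails≡∧digits≡)
    kφx≋kψx : k * φ x ≋ k * ψ x
    kφx≋kψx = begin
      k * φ x       ≈⟨ χ-· (partial X) (total X x) k ⟨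
      φ (k · x)     ≈⟨ agree-on-span k·a∈H ⟩
      ψ (k · x)     ≈⟨ χ-· (partial Y) (total Y x) k ⟩
      k * ψ x       ∎
    agree-at-x : φ x ≋ ψ x
    agree-at-x = k*c≋k*d∧[c%N]/u≡[d%N]/u⇒c≋d k u (φ x) (ψ x) N≡k*u kφx≋kψx (proj₂ tails≡∧digits≡)

  zeroCharacter : Subgroup → PartialCharacter
  zeroCharacter K = record { domain = K ; χ = λ _ → 0 ; χ-∙ = λ _ _ → refl }

  record Separation (K : Subgroup) (a : Fin n) : Set₁ where
    field
      character : Character
      vanishes : ∀ {x} → member K x → χ (partial character) x ≋ 0
      separates : ¬ χ (partial character) a ≋ 0

  -- Extend the zero character of K to K⟨a⟩ by a ↦ u = N / k, which is nonzero mod N as k > 1, then to all of G.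
  separate : (K : Subgroup) {a : Fin n} → ¬ member K a → Separation K a
  separate K {a} a∉K = record
    { character = extendToCharacter P
    ; vanishes = λ x∈K → trans (extendAlong-agrees P (allFin n) (H⊆join x∈K)) (extension-agrees u ku≋0 x∈K)
    ; separates = λ χa≋0 → ≢-nonZero⁻¹ u (m<N∧m≋0⇒m≡0 u<N (trans (sym χa≋u) χa≋0))
    }
    where
    open Join (relativeOrder K a)
    open Extension (zeroCharacter K) (relativeOrder K a)
    ku≋0 : k * u ≋ 0
    ku≋0 = trans (cong (_% N) (sym N≡k*u)) N≋0
    P = extension u ku≋0
    χa≋u : χ (extendAlong P (allFin n)) a ≋ u
    χa≋u = trans (extendAlong-agrees P (allFin n) a∈join) (extension-at-a u ku≋0)
    1<k : 1 < k
    1<k = ≤∧≢⇒< (>-nonZero⁻¹ k) λ 1≡k → a∉K (subst (member K) (×-homo-1 a) (subst (λ m → member K (m · a)) (sym 1≡k) k·a∈H))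
    u<N : u < N
    u<N = subst (u <_) (trans (*-comm u k) (sym N≡k*u)) (m<m*n u k 1<k)

  kernel : Character → Subset n
  kernel X = subsetOf (λ x → χ (partial X) x % N ℕ.≟ 0 % N)

  ∈kernel⁺ : ∀ X {x} → χ (partial X) x ≋ 0 → x ∈ kernel X
  ∈kernel⁺ X = ∈subsetOf⁺ _

  ∈kernel⁻ : ∀ X {x} → x ∈ kernel X → χ (partial X) x ≋ 0
  ∈kernel⁻ X = ∈subsetOf⁻ _

  kernel-subgroup : ∀ X → IsSubgroup G (kernel X)
  kernel-subgroup X =
      ∈kernel⁺ X (χ-ε φ)
    , (λ x y x∈ y∈ → ∈kernel⁺ X (trans (χ-∙ φ (total X x) (total X y)) (+-cong-≋ (∈kernel⁻ X x∈) (∈kernel⁻ X y∈))))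
    , λ x x∈ → ∈kernel⁺ X (begin
        χ φ (x ⁻¹)                ≡⟨ +-identityʳ _ ⟨
        χ φ (x ⁻¹) + 0            ≈⟨ +-congˡ-≋ (χ φ (x ⁻¹)) (∈kernel⁻ X x∈) ⟨
        χ φ (x ⁻¹) + χ φ x        ≈⟨ χ-∙ φ (total X (x ⁻¹)) (total X x) ⟨
        χ φ ((x ⁻¹) ∙ x)          ≡⟨ cong (χ φ) (inverseˡ x) ⟩
        χ φ ε                     ≈⟨ χ-ε φ ⟩
        0                         ∎)
    where
    φ = partial X
    open SetoidReasoning ≋-setoid

  ⟨_⟩ : Subset n → Subgroup
  ⟨ S ⟩ = span (members S)

  ⟨⟩⊆Gen : ∀ S {y} → member ⟨ S ⟩ y → Gen G S y
  ⟨⟩⊆Gen S = span⊆Gen (members S) (gen ∘ ∈members⁻ S)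

  separator : Subset n → Character
  separator S with Fin.any? (λ a → ¬? (member? ⟨ S ⟩ a))
  ... | yes (_ , a∉⟨S⟩) = Separation.character (separate ⟨ S ⟩ a∉⟨S⟩)
  ... | no _ = extendToCharacter (zeroCharacter trivial)   -- junk: S generates G

  separator-spec : ∀ S → ¬ (∀ a → Gen G S a) → S ⊆ kernel (separator S) × ∃[ a ] a ∉ kernel (separator S)
  separator-spec S ¬gen with Fin.any? (λ a → ¬? (member? ⟨ S ⟩ a))
  ... | yes (a , a∉⟨S⟩) =
        (λ x∈S → ∈kernel⁺ character (vanishes (span-∋ (∈members⁺ x∈S))))
      , a , λ a∈ker → separates (∈kernel⁻ character a∈ker)
    where open Separation (separate ⟨ S ⟩ a∉⟨S⟩)
  ... | no ∄a∉⟨S⟩ = ⊥-elim (¬gen λ a → ⟨⟩⊆Gen S (decidable-stable (member? ⟨ S ⟩ a) λ a∉⟨S⟩ → ∄a∉⟨S⟩ (a , a∉⟨S⟩)))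

  codeOf : Subset n → Fin n
  codeOf S = code (partial (separator S)) (allFin n)

  codeOf≡⇒kernel⊆ : ∀ {S S′} → codeOf S ≡ codeOf S′ → kernel (separator S) ⊆ kernel (separator S′)
  codeOf≡⇒kernel⊆ {S} {S′} codes≡ {x} x∈ker = ∈kernel⁺ (separator S′) (trans (sym χx≋χ′x) (∈kernel⁻ (separator S) x∈ker))
    where
    χx≋χ′x = code-injective (separator S) (separator S′) (allFin n) codes≡ (span-∋ (∈-allFin x))

  module _ {B : Subset n} (B≤G : IsSubgroup G B) (2∣B∣≡n : 2 * ∣ B ∣ ≡ n) where

    length≤n*2^[n/4] : ∀ {L} → Unique L → All (λ S → (∀ x → x ∈ S → x ∉ B) × ¬ (∀ a → Gen G S a)) L →
                  length L ≤ n * 2 ^ (n / 4)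
    length≤n*2^[n/4] {L} L! L-ok = length≤fibres codeOf L! λ c →
      unique-family-length≤ Y (Unique.filter⁺ (hasCode c) L!) (F⊆Y c) (∣Y∣≤n/4 ∘ proj₁ ∘ ∈-filter⁻ (hasCode c) {xs = L})
      where
      hasCode : ∀ c S → Dec (codeOf S ≡ c)
      hasCode c S = codeOf S Fin.≟ c
      Y : Subset n → Subset n
      Y S = kernel (separator S) ∩ ∁ B
      F⊆Y : ∀ c {S S′} → S ∈ₗ fibre codeOf c L → S′ ∈ₗ fibre codeOf c L → S ⊆ Y S′
      F⊆Y c S∈F S′∈F x∈S with ∈-filter⁻ (hasCode c) {xs = L} S∈F | ∈-filter⁻ (hasCode c) {xs = L} S′∈F
      ... | S∈L , codeS≡c | _ , codeS′≡c =
        x∈p∩q⁺ ( codeOf≡⇒kernel⊆ (trans codeS≡c (sym codeS′≡c)) (proj₁ (separator-spec _ (proj₂ S-ok)) x∈S)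
               , x∉p⇒x∈∁p (proj₁ S-ok _ x∈S))
        where S-ok = All.lookup L-ok S∈L
      ∣Y∣≤n/4 : ∀ {S} → S ∈ₗ L → ∣ Y S ∣ ≤ n / 4
      ∣Y∣≤n/4 {S} S∈L with separator-spec S (proj₂ (All.lookup L-ok S∈L))
      ... | _ , a , a∉ker = subst (_≤ n / 4) (m*n/n≡m ∣ Y S ∣ 4)
        (/-monoˡ-≤ 4 (subst (_≤ n) (*-comm 4 ∣ Y S ∣) (4∣K∖B∣≤n B≤G 2∣B∣≡n (kernel-subgroup (separator S)) a∉ker)))

lemma3p1 : (n : ℕ) (G : FinAbGroup n) (B : Subset n)
    → IsSubgroup G B
    → 2 * ∣ B ∣ ≡ n
    → (L : List (Subset n))
    → Unique L
    → All (λ S → (∀ x → x ∈ S → x ∉ B) × ¬ (∀ a → Gen G S a)) L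
    → length L ^ 4 ≤ 2 ^ n * n ^ 4
lemma3p1 n G B B≤G 2∣B∣≡n L L! L-ok = begin
  length L ^ 4               ≤⟨ ^-monoˡ-≤ 4 (length≤n*2^[n/4] G B≤G 2∣B∣≡n L! L-ok) ⟩
  (n * 2 ^ (n / 4)) ^ 4      ≤⟨ [m*2^[m/4]]^4≤2^m*m^4 n ⟩
  2 ^ n * n ^ 4              ∎
  where open ≤-Reasoning
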